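{- Let $G=Q_n(X)$ be a daisy cube and $ab\in E(G)$. If $|W_{ab}|=|W_{ba}|$, then there exists a proper labelling of $G$ in which the vertex labelled by the all-zero string lies in $W_{ab}$, and there exists a proper labelling of $G$ in which the vertex labelled by the all-zero string lies in $W_{ba}$.
   Context: $B=\{0,1\}$; $Q_k$ has vertex set $B^k$ (binary strings of length $k$), two strings adjacent iff they differ in exactly one position. For $u,v\in B^k$ write $u\le v$ if $u_i\le v_i$ for all $i$. For $X\subseteq B^k$ the daisy cube $Q_k(X)$ is the subgraph of $Q_k$ induced by $\{u: u\le x\text{ for some }x\in X\}$. A labelling of a graph $G$ is an isometric embedding $\varphi$ of $G$ into some hypercube $Q_k$ (assigning to each vertex a binary string); it is proper if the image $\varphi(V(G))$ is closed downward under $\le$, i.e. $G$ is isomorphic via $\varphi$ to the daisy cube $Q_k(\varphi(V(G)))$. For an edge $ab$ of $G$ (distances in $G$): $W_{ab}=\{w: d(a,w)<d(b,w)\}$, $W_{ba}=\{w: d(b,w)<d(a,w)\}$. -}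

module Defs where

open import Data.Nat using (ℕ; zero; suc; _≤_; _<_)
open import Data.Bool using (Bool; true; false; _xor_) renaming (_≤_ to _≤B_)
open import Data.Vec using (Vec; []; _∷_; replicate)
open import Data.Vec.Relation.Binary.Pointwise.Inductive using (Pointwise)
open import Data.List using (List; length)
open import Data.List.Membership.Propositional using (_∈_)
open import Data.List.Relation.Unary.Unique.Propositional using (Unique)
open import Data.Product using (Σ; ∃; ∃-syntax; _×_; _,_)
open import Relation.Binary.PropositionalEquality using (_≡_)
open import Function.Bundles using (_⇔_)

BStr : ℕ → Set
BStr k = Vec Bool k

_≼_ : ∀ {k} → BStr k → BStr k → Set
u ≼ v = Pointwise _≤B_ u v

ham : ∀ {k} → BStr k → BStr k → ℕ
ham [] [] = 0
ham (x ∷ u) (y ∷ v) with x xor y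
... | true  = suc (ham u v)
... | false = ham u v

Adj : ∀ {k} → BStr k → BStr k → Set
Adj u v = ham u v ≡ 1

InDaisy : ∀ {n} → List (BStr n) → BStr n → Set
InDaisy X u = ∃[ x ] (x ∈ X × u ≼ x)

data Walk {n} (P : BStr n → Set) : BStr n → BStr n → ℕ → Set where
  here : ∀ {u} → P u → Walk P u u 0
  step : ∀ {u v w ℓ} → P u → Adj u v → Walk P v w ℓ → Walk P u w (suc ℓ)

Dist : ∀ {n} → (BStr n → Set) → BStr n → BStr n → ℕ → Set
Dist P u v d = Walk P u v d × (∀ ℓ → Walk P u v ℓ → d ≤ ℓ)

InW : ∀ {n} → List (BStr n) → BStr n → BStr n → BStr n → Set
InW X a b w = InDaisy X w × ∃[ da ] ∃[ db ]
  (Dist (InDaisy X) a w da × Dist (InDaisy X) b w db × da < db)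

HasCard : ∀ {n} → (BStr n → Set) → ℕ → Set
HasCard {n} P c = Σ (List (BStr n)) λ L → Unique L × (∀ w → (w ∈ L ⇔ P w)) × length L ≡ c

SameSizeW : ∀ {n} → List (BStr n) → BStr n → BStr n → Set
SameSizeW X a b = ∃[ c ] (HasCard (InW X a b) c × HasCard (InW X b a) c)

ProperLabelling : ∀ {n} → List (BStr n) → (k : ℕ) → (BStr n → BStr k) → Set
ProperLabelling {n} X k φ =
  (∀ u v → InDaisy X u → InDaisy X v → Dist (InDaisy X) u v (ham (φ u) (φ v)))
  × (∀ (y : BStr k) (u : BStr n) → InDaisy X u → y ≼ φ u →
       ∃[ u' ] (InDaisy X u' × φ u' ≡ y))

ProperLabellingZeroIn : ∀ {n} → List (BStr n) → (BStr n → Set) → Set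
ProperLabellingZeroIn {n} X Q = ∃[ k ] Σ (BStr n → BStr k) λ φ →
  ProperLabelling X k φ ×
  ∃[ w ] (InDaisy X w × φ w ≡ replicate k false × Q w)

module Submission where

-- Let G = Q_n(X) be a daisy cube and ab an edge of G, so that b is a with one
-- coordinate i flipped; by symmetry we may assume a_i = 0 and b_i = 1.
--
-- 1. G is an isometric subgraph of Q_n: between two vertices u, v there is a
--    geodesic of Q_n staying below u or below v, hence inside G.  So the
--    identity is a proper labelling, and W_ab = {w ∈ G | w_i = 0},
--    W_ba = {w ∈ G | w_i = 1}.
-- 2. Clearing coordinate i maps W_ba injectively into W_ab (G is closed
--    downward).  If |W_ab| = |W_ba| this injection is onto (a counting
--    argument on duplicate-free lists), so flipping coordinate i maps G onto
--    itself.
-- 3. An involutive isometry of Q_n preserving V(G) is a proper labelling.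
--    The identity puts the all-zero label on 0 ∈ W_ab; flipping coordinate i
--    puts it on e_i ∈ W_ba.

open import Defs
open import Data.Nat using (ℕ; suc; _+_; _≤_; _<_; z≤n; s≤s)
open import Data.Nat.Properties
  using (≤-antisym; ≤-reflexive; +-mono-≤; +-suc; <-asym; <-irrefl; suc-injective; +-commutativeSemigroup; module ≤-Reasoning)
open import Algebra.Properties.CommutativeSemigroup +-commutativeSemigroup using (interchange)
open import Data.Bool using (Bool; true; false; not; _xor_; if_then_else_; b≤b; f≤t) renaming (_≤_ to _≤B_)
import Data.Bool.Properties as Bool
open import Data.Fin using (Fin; zero; suc)
open import Data.Vec using ([]; _∷_; replicate; lookup)
open import Data.Vec.Properties using (≡-dec; lookup-replicate)
open import Data.Vec.Relation.Binary.Pointwise.Inductive as Pointwise using ([]; _∷_)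
open import Data.List using (List; []; _∷_; length; map; filter)
open import Data.List.Properties using (length-map; filter-notAll)
open import Data.List.Membership.Propositional using (_∈_)
open import Data.List.Membership.Propositional.Properties using (∈-map⁻; ∈-filter⁺)
open import Data.List.Membership.DecPropositional using (_∈?_)
open import Data.List.Relation.Unary.Any as Any using (here; there)
import Data.List.Relation.Unary.All as All
open import Data.List.Relation.Unary.All.Properties using (¬Any⇒All¬)
open import Data.List.Relation.Unary.Unique.Propositional using (Unique)
open import Data.List.Relation.Unary.AllPairs using (_∷_)
open import Data.List.Relation.Unary.Unique.Propositional.Properties using (map⁺)
open import Data.Product using (∃-syntax; _×_; _,_; proj₁; map₂; swap)
open import Data.Sum using (_⊎_; inj₁; inj₂)
open import Data.Empty using (⊥-elim)
open import Function using (id; _∘_)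
open import Function.Bundles using (Equivalence)
open import Relation.Binary.Definitions using (DecidableEquality)
open import Relation.Nullary using (¬_; Dec; yes; no; ¬?)
open import Relation.Binary.PropositionalEquality
  using (_≡_; refl; sym; trans; cong; cong₂; subst; subst₂; module ≡-Reasoning)

open Equivalence using (to; from)

≼-refl : ∀ {k} {u : BStr k} → u ≼ u
≼-refl = Pointwise.refl Bool.≤-refl

≼-trans : ∀ {k} {u v w : BStr k} → u ≼ v → v ≼ w → u ≼ w
≼-trans = Pointwise.trans Bool.≤-trans

zeros≼ : ∀ {k} (v : BStr k) → replicate k false ≼ v
zeros≼ [] = []
zeros≼ (x ∷ v) = Bool.≤-minimum x ∷ zeros≼ v

daisy-down : ∀ {n} {X : List (BStr n)} {u y} → InDaisy X u → y ≼ u → InDaisy X y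
daisy-down (x , x∈X , u≼x) y≼u = x , x∈X , ≼-trans y≼u u≼x

bitDist : Bool → Bool → ℕ
bitDist x y = if x xor y then 1 else 0

ham-∷ : ∀ {k} x y (u v : BStr k) → ham (x ∷ u) (y ∷ v) ≡ bitDist x y + ham u v
ham-∷ x y u v with x xor y
... | true = refl
... | false = refl

ham-∷-same : ∀ {k} x (u v : BStr k) → ham (x ∷ u) (x ∷ v) ≡ ham u v
ham-∷-same false u v = refl
ham-∷-same true u v = refl

ham-self : ∀ {k} (u : BStr k) → ham u u ≡ 0
ham-self [] = refl
ham-self (false ∷ u) = ham-self u
ham-self (true ∷ u) = ham-self u

ham≡0⇒≡ : ∀ {k} (u v : BStr k) → ham u v ≡ 0 → u ≡ v
ham≡0⇒≡ [] [] _ = refl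
ham≡0⇒≡ (false ∷ u) (false ∷ v) e = cong (false ∷_) (ham≡0⇒≡ u v e)
ham≡0⇒≡ (true ∷ u) (true ∷ v) e = cong (true ∷_) (ham≡0⇒≡ u v e)

bitDist-triangle : ∀ x y z → bitDist x z ≤ bitDist x y + bitDist y z
bitDist-triangle false false false = z≤n
bitDist-triangle false false true = s≤s z≤n
bitDist-triangle false true false = z≤n
bitDist-triangle false true true = s≤s z≤n
bitDist-triangle true false false = s≤s z≤n
bitDist-triangle true false true = z≤n
bitDist-triangle true true false = s≤s z≤n
bitDist-triangle true true true = z≤n

ham-triangle : ∀ {k} (u v w : BStr k) → ham u w ≤ ham u v + ham v w
ham-triangle [] [] [] = z≤n
ham-triangle (x ∷ u) (y ∷ v) (z ∷ w) = begin
  ham (x ∷ u) (z ∷ w)                              ≡⟨ ham-∷ x z u w ⟩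
  bitDist x z + ham u w                            ≤⟨ +-mono-≤ (bitDist-triangle x y z) (ham-triangle u v w) ⟩
  (bitDist x y + bitDist y z) + (ham u v + ham v w) ≡⟨ interchange (bitDist x y) (bitDist y z) (ham u v) (ham v w) ⟩
  (bitDist x y + ham u v) + (bitDist y z + ham v w) ≡⟨ sym (cong₂ _+_ (ham-∷ x y u v) (ham-∷ y z v w)) ⟩
  ham (x ∷ u) (y ∷ v) + ham (y ∷ v) (z ∷ w)        ∎
  where open ≤-Reasoning

-- Walks in an induced subgraph of Q_k: each edge changes the Hamming distance
-- to a fixed vertex by at most one, so no walk is shorter than the Hamming
-- distance of its ends.

walk-length≥ham : ∀ {n} {P : BStr n → Set} {u v ℓ} → Walk P u v ℓ → ham u v ≤ ℓ
walk-length≥ham {u = u} (here _) = ≤-reflexive (ham-self u)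
walk-length≥ham {u = u} {w} (step {v = v} {ℓ = ℓ} _ u~v walk) = begin
  ham u w           ≤⟨ ham-triangle u v w ⟩
  ham u v + ham v w ≡⟨ cong (_+ ham v w) u~v ⟩
  suc (ham v w)     ≤⟨ s≤s (walk-length≥ham walk) ⟩
  suc ℓ             ∎
  where open ≤-Reasoning

walk-snoc : ∀ {n} {P : BStr n → Set} {u v w ℓ} → Walk P u v ℓ → P w → Adj v w → Walk P u w (suc ℓ)
walk-snoc (here pu) pw v~w = step pu v~w (here pw)
walk-snoc (step pu u~v walk) pw v~w = step pu u~v (walk-snoc walk pw v~w)

walk-mono : ∀ {n} {P Q : BStr n → Set} {u v ℓ} → (∀ {y} → P y → Q y) → Walk P u v ℓ → Walk Q u v ℓ
walk-mono P⊆Q (here pu) = here (P⊆Q pu)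
walk-mono P⊆Q (step pu u~v walk) = step (P⊆Q pu) u~v (walk-mono P⊆Q walk)

walk-∷ : ∀ {n} {P : BStr n → Set} {Q : BStr (suc n) → Set} {u v ℓ} (x : Bool) →
  (∀ {y} → P y → Q (x ∷ y)) → Walk P u v ℓ → Walk Q (x ∷ u) (x ∷ v) ℓ
walk-∷ x P⇒Q (here pu) = here (P⇒Q pu)
walk-∷ x P⇒Q (step {u = u} {v = v} pu u~v walk) =
  step (P⇒Q pu) (trans (ham-∷-same x u v) u~v) (walk-∷ x P⇒Q walk)

Below₂ : ∀ {k} → BStr k → BStr k → BStr k → Set
Below₂ u v y = y ≼ u ⊎ y ≼ v

below₂-∷ : ∀ {k} {x x' z} {u v y : BStr k} → z ≤B x → z ≤B x' → Below₂ u v y → Below₂ (x ∷ u) (x' ∷ v) (z ∷ y)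
below₂-∷ z≤x z≤x' (inj₁ y≼u) = inj₁ (z≤x ∷ y≼u)
below₂-∷ z≤x z≤x' (inj₂ y≼v) = inj₂ (z≤x' ∷ y≼v)

-- A geodesic of Q_k from u to v which stays below u or below v: first clear
-- the coordinates where u is 1 and v is 0, then set those where u is 0 and v is 1.
geodesic : ∀ {k} (u v : BStr k) → Walk (Below₂ u v) u v (ham u v)
geodesic [] [] = here (inj₁ [])
geodesic (false ∷ u) (false ∷ v) = walk-∷ false (below₂-∷ b≤b b≤b) (geodesic u v)
geodesic (true ∷ u) (true ∷ v) = walk-∷ true (below₂-∷ b≤b b≤b) (geodesic u v)
geodesic (true ∷ u) (false ∷ v) =
  step (inj₁ ≼-refl) (cong suc (ham-self u)) (walk-∷ false (below₂-∷ f≤t b≤b) (geodesic u v))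
geodesic (false ∷ u) (true ∷ v) =
  walk-snoc (walk-∷ false (below₂-∷ b≤b f≤t) (geodesic u v)) (inj₂ ≼-refl) (cong suc (ham-self v))

daisy-isometric : ∀ {n} {X : List (BStr n)} {u v} → InDaisy X u → InDaisy X v → Dist (InDaisy X) u v (ham u v)
daisy-isometric {u = u} {v} du dv = walk-mono inDaisy (geodesic u v) , λ _ → walk-length≥ham
  where
    inDaisy : ∀ {y} → Below₂ u v y → InDaisy _ y
    inDaisy (inj₁ y≼u) = daisy-down du y≼u
    inDaisy (inj₂ y≼v) = daisy-down dv y≼v

dist-unique : ∀ {n} {P : BStr n → Set} {u v d d'} → Dist P u v d → Dist P u v d' → d ≡ d'
dist-unique (walk , shortest) (walk' , shortest') = ≤-antisym (shortest _ walk') (shortest' _ walk)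

flipAt : ∀ {k} → Fin k → BStr k → BStr k
flipAt zero (x ∷ u) = not x ∷ u
flipAt (suc i) (x ∷ u) = x ∷ flipAt i u

flip-involutive : ∀ {k} (i : Fin k) u → flipAt i (flipAt i u) ≡ u
flip-involutive zero (x ∷ u) = cong (_∷ u) (Bool.not-involutive x)
flip-involutive (suc i) (x ∷ u) = cong (x ∷_) (flip-involutive i u)

flip-injective : ∀ {k} (i : Fin k) {u v} → flipAt i u ≡ flipAt i v → u ≡ v
flip-injective i {u} {v} e = begin
  u                       ≡⟨ sym (flip-involutive i u) ⟩
  flipAt i (flipAt i u)   ≡⟨ cong (flipAt i) e ⟩
  flipAt i (flipAt i v)   ≡⟨ flip-involutive i v ⟩
  v                       ∎
  where open ≡-Reasoning

flip-isometry : ∀ {k} (i : Fin k) u v → ham (flipAt i u) (flipAt i v) ≡ ham u v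
flip-isometry zero (false ∷ u) (false ∷ v) = refl
flip-isometry zero (false ∷ u) (true ∷ v) = refl
flip-isometry zero (true ∷ u) (false ∷ v) = refl
flip-isometry zero (true ∷ u) (true ∷ v) = refl
flip-isometry (suc i) (x ∷ u) (y ∷ v) = begin
  ham (x ∷ flipAt i u) (y ∷ flipAt i v)        ≡⟨ ham-∷ x y _ _ ⟩
  bitDist x y + ham (flipAt i u) (flipAt i v)  ≡⟨ cong (bitDist x y +_) (flip-isometry i u v) ⟩
  bitDist x y + ham u v                        ≡⟨ sym (ham-∷ x y u v) ⟩
  ham (x ∷ u) (y ∷ v)                          ∎
  where open ≡-Reasoning

lookup-flip : ∀ {k} (i : Fin k) u → lookup (flipAt i u) i ≡ not (lookup u i)
lookup-flip zero (x ∷ u) = refl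
lookup-flip (suc i) (x ∷ u) = lookup-flip i u

flip≼ : ∀ {k} (i : Fin k) u → lookup u i ≡ true → flipAt i u ≼ u
flip≼ zero (true ∷ u) refl = f≤t ∷ ≼-refl
flip≼ (suc i) (x ∷ u) ui = b≤b ∷ flip≼ i u ui

ham-flip-agree : ∀ {k} (i : Fin k) a w → lookup w i ≡ lookup a i → ham (flipAt i a) w ≡ suc (ham a w)
ham-flip-agree zero (false ∷ a) (.false ∷ w) refl = refl
ham-flip-agree zero (true ∷ a) (.true ∷ w) refl = refl
ham-flip-agree (suc i) (x ∷ a) (y ∷ w) agree = begin
  ham (x ∷ flipAt i a) (y ∷ w)      ≡⟨ ham-∷ x y _ w ⟩
  bitDist x y + ham (flipAt i a) w  ≡⟨ cong (bitDist x y +_) (ham-flip-agree i a w agree) ⟩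
  bitDist x y + suc (ham a w)       ≡⟨ +-suc (bitDist x y) (ham a w) ⟩
  suc (bitDist x y + ham a w)       ≡⟨ cong suc (sym (ham-∷ x y a w)) ⟩
  suc (ham (x ∷ a) (y ∷ w))         ∎
  where open ≡-Reasoning

ham-flip-disagree : ∀ {k} (i : Fin k) a w → ¬ lookup w i ≡ lookup a i → ham a w ≡ suc (ham (flipAt i a) w)
ham-flip-disagree i a w disagree = begin
  ham a w                          ≡⟨ cong (λ t → ham t w) (sym (flip-involutive i a)) ⟩
  ham (flipAt i (flipAt i a)) w    ≡⟨ ham-flip-agree i (flipAt i a) w agree-flipped ⟩
  suc (ham (flipAt i a) w)         ∎
  where
    open ≡-Reasoning
    agree-flipped : lookup w i ≡ lookup (flipAt i a) i
    agree-flipped = trans (Bool.¬-not disagree) (sym (lookup-flip i a))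

Raise : ∀ {k} → Fin k → BStr k → BStr k → Set
Raise i a b = lookup a i ≡ false × b ≡ flipAt i a

raise-∷ : ∀ {k} x {i : Fin k} {a b} → Raise i a b → Raise (suc i) (x ∷ a) (x ∷ b)
raise-∷ x (ai , refl) = ai , refl

adjacent-raise : ∀ {k} (a b : BStr k) → Adj a b → ∃[ i ] (Raise i a b ⊎ Raise i b a)
adjacent-raise [] [] ()
adjacent-raise (false ∷ a) (false ∷ b) a~b =
  Data.Product.map suc (Data.Sum.map (raise-∷ false) (raise-∷ false)) (adjacent-raise a b a~b)
adjacent-raise (true ∷ a) (true ∷ b) a~b =
  Data.Product.map suc (Data.Sum.map (raise-∷ true) (raise-∷ true)) (adjacent-raise a b a~b)
adjacent-raise (false ∷ a) (true ∷ b) a~b = zero , inj₁ (refl , cong (true ∷_) (sym (ham≡0⇒≡ a b (suc-injective a~b))))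
adjacent-raise (true ∷ a) (false ∷ b) a~b = zero , inj₂ (refl , cong (true ∷_) (ham≡0⇒≡ a b (suc-injective a~b)))

-- Since distances in G are Hamming distances,
-- w ∈ W_pq means that w is Hamming-closer to p than to q; for an edge along
-- coordinate i this says exactly that w agrees with p at i.

W-closer : ∀ {n} {X : List (BStr n)} {p q w} → InDaisy X p → InDaisy X q → InW X p q w → ham p w < ham q w
W-closer dp dq (dw , da , db , Da , Db , da<db) =
  subst₂ _<_ (dist-unique Da (daisy-isometric dp dw)) (dist-unique Db (daisy-isometric dq dw)) da<db

W-agrees : ∀ {n} {X : List (BStr n)} {i p q w} → InDaisy X p → InDaisy X q → q ≡ flipAt i p →
  InW X p q w → lookup w i ≡ lookup p i
W-agrees {i = i} {p} {w = w} dp dq refl w∈W with lookup w i Bool.≟ lookup p i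
... | yes agree = agree
... | no disagree =
  ⊥-elim (<-asym (W-closer dp dq w∈W) (≤-reflexive (sym (ham-flip-disagree i p w disagree))))

W-intro : ∀ {n} {X : List (BStr n)} {i p q w} → InDaisy X p → InDaisy X q → q ≡ flipAt i p →
  InDaisy X w → lookup w i ≡ lookup p i → InW X p q w
W-intro {i = i} {p} {w = w} dp dq refl dw agree =
  dw , ham p w , ham (flipAt i p) w , daisy-isometric dp dw , daisy-isometric dq dw ,
  ≤-reflexive (sym (ham-flip-agree i p w agree))

-- Counting.  A duplicate-free list contained in another is no longer: remove
-- its head from the bigger list and recurse.
unique-⊆-length : ∀ {a} {A : Set a} → DecidableEquality A → {xs ys : List A} →
  Unique xs → (∀ {x} → x ∈ xs → x ∈ ys) → length xs ≤ length ys
unique-⊆-length _≟_ {[]} _ _ = z≤n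
unique-⊆-length {A = A} _≟_ {x ∷ xs} {ys} (x∉xs ∷ xs-unique) xs⊆ys = begin-strict
  length xs            ≤⟨ unique-⊆-length _≟_ xs-unique (λ y∈xs → ∈-filter⁺ differs (xs⊆ys (there y∈xs)) (All.lookup x∉xs y∈xs)) ⟩
  length (filter differs ys) <⟨ filter-notAll differs ys (Any.map (λ x≡y x≢y → x≢y x≡y) (xs⊆ys (here refl))) ⟩
  length ys            ∎
  where
    open ≤-Reasoning
    differs : (y : A) → Dec (¬ x ≡ y)
    differs = ¬? ∘ (x ≟_)

_≟ₙ_ : ∀ {n} → DecidableEquality (BStr n)
_≟ₙ_ = ≡-dec Bool._≟_

injection-onto : ∀ {n} {P Q : BStr n → Set} {c} (f : BStr n → BStr n) →
  (∀ {x y} → f x ≡ f y → x ≡ y) → (∀ {v} → Q v → P (f v)) →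
  HasCard P c → HasCard Q c → ∀ {w} → P w → ∃[ v ] (Q v × f v ≡ w)
injection-onto f f-inj Q⇒P (LP , _ , memP , lenP) (LQ , LQ-unique , memQ , lenQ) {w} Pw
  with _∈?_ _≟ₙ_ w (map f LQ)
... | yes w∈img with ∈-map⁻ f w∈img
...   | v , v∈LQ , refl = v , to (memQ v) v∈LQ , refl
injection-onto f f-inj Q⇒P (LP , _ , memP , lenP) (LQ , LQ-unique , memQ , lenQ) {w} Pw
    | no w∉img = ⊥-elim (<-irrefl refl too-long)
  where
    ⊆LP : ∀ {x} → x ∈ w ∷ map f LQ → x ∈ LP
    ⊆LP (here refl) = from (memP w) Pw
    ⊆LP (there x∈img) with ∈-map⁻ f x∈img
    ... | v , v∈LQ , refl = from (memP (f v)) (Q⇒P (to (memQ v) v∈LQ))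

    too-long : suc (length (map f LQ)) ≤ length (map f LQ)
    too-long = subst (suc (length (map f LQ)) ≤_)
      (trans lenP (sym (trans (length-map f LQ) lenQ)))
      (unique-⊆-length _≟ₙ_ (¬Any⇒All¬ _ w∉img ∷ map⁺ f-inj LQ-unique) ⊆LP)

-- An involutive isometry of Q_n mapping V(G) into itself
-- is a proper labelling of the daisy cube G: it preserves distances because G
-- is isometric, and its image V(G) is closed downward.
involution-proper : ∀ {n} (X : List (BStr n)) (φ : BStr n → BStr n) →
  (∀ u v → ham (φ u) (φ v) ≡ ham u v) → (∀ u → φ (φ u) ≡ u) →
  (∀ {u} → InDaisy X u → InDaisy X (φ u)) → ProperLabelling X n φ
involution-proper X φ isometry involutive closed =
  (λ u v du dv → subst (Dist (InDaisy X) u v) (sym (isometry u v)) (daisy-isometric du dv)) ,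
  λ y u du y≼φu → φ y , closed (daisy-down (closed du) y≼φu) , involutive y

W-lower : ∀ {n} {X : List (BStr n)} {i p q v} → Raise i p q → InDaisy X p → InDaisy X q →
  InW X q p v → InW X p q (flipAt i v)
W-lower {i = i} {p} {v = v} (pi≡0 , refl) dp dq v∈W =
  W-intro dp dq refl (daisy-down (proj₁ v∈W) (flip≼ i v vi≡1)) lowered
  where
    vi≡1 : lookup v i ≡ true
    vi≡1 = trans (W-agrees dq dp (sym (flip-involutive i p)) v∈W) (trans (lookup-flip i p) (cong not pi≡0))
    lowered : lookup (flipAt i v) i ≡ lookup p i
    lowered = trans (lookup-flip i v) (trans (cong not vi≡1) (sym pi≡0))

-- If |W_pq| = |W_qp| for an edge p → q raising i, then V(G) is closed under
-- flipping coordinate i: raising is the inverse of the lowering injection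
-- W_qp → W_pq, which is onto by counting; lowering stays in G anyway.
flip-closed : ∀ {n} {X : List (BStr n)} {i p q} → Raise i p q → InDaisy X p → InDaisy X q →
  SameSizeW X p q → ∀ {w} → InDaisy X w → InDaisy X (flipAt i w)
flip-closed {i = i} raise@(pi≡0 , refl) dp dq (_ , card-pq , card-qp) {w} dw with lookup w i in wi
... | true = daisy-down dw (flip≼ i w wi)
... | false with injection-onto (flipAt i) (flip-injective i) (W-lower raise dp dq) card-pq card-qp
                   (W-intro dp dq refl dw (trans wi (sym pi≡0)))
...   | v , v∈W , refl = subst (InDaisy _) (sym (flip-involutive i v)) (proj₁ v∈W)

zero-in-lower-side : ∀ {n} {X : List (BStr n)} {i p q} → Raise i p q → InDaisy X p → InDaisy X q →
  ProperLabellingZeroIn X (InW X p q)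
zero-in-lower-side {n} {X} {i} {p} (pi≡0 , refl) dp dq =
  n , id , involution-proper X id (λ _ _ → refl) (λ _ → refl) id ,
  replicate n false , d0 , refl , W-intro dp dq refl d0 (trans (lookup-replicate i false) (sym pi≡0))
  where
    d0 : InDaisy X (replicate n false)
    d0 = daisy-down dp (zeros≼ p)

zero-in-upper-side : ∀ {n} {X : List (BStr n)} {i p q} → Raise i p q → InDaisy X p → InDaisy X q →
  SameSizeW X p q → ProperLabellingZeroIn X (InW X q p)
zero-in-upper-side {n} {X} {i} {p} raise@(pi≡0 , refl) dp dq same =
  n , flipAt i , involution-proper X (flipAt i) (flip-isometry i) (flip-involutive i) closed ,
  flipAt i zeros , de , flip-involutive i zeros ,
  W-intro dq dp (sym (flip-involutive i p)) de agree
  where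
    zeros : BStr n
    zeros = replicate n false
    closed : ∀ {w} → InDaisy X w → InDaisy X (flipAt i w)
    closed = flip-closed raise dp dq same
    de : InDaisy X (flipAt i zeros)
    de = closed (daisy-down dp (zeros≼ p))
    agree : lookup (flipAt i zeros) i ≡ lookup (flipAt i p) i
    agree = trans (lookup-flip i zeros)
      (trans (cong not (trans (lookup-replicate i false) (sym pi≡0))) (sym (lookup-flip i p)))

proposition3p2 : (n : ℕ) (X : List (BStr n)) (a b : BStr n) →
    InDaisy X a → InDaisy X b → Adj a b →
    SameSizeW X a b →
    ProperLabellingZeroIn X (InW X a b) × ProperLabellingZeroIn X (InW X b a)
proposition3p2 n X a b da db a~b same with adjacent-raise a b a~b
... | i , inj₁ a↑b = zero-in-lower-side a↑b da db , zero-in-upper-side a↑b da db same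
... | i , inj₂ b↑a = zero-in-upper-side b↑a db da (map₂ swap same) , zero-in-lower-side b↑a db da
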